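{- For every odd integer $m\ge 3$, \[\mathcal H_{m,2}(X;q,t)=C_{m,2}(q,t)\,s_{(1,1)}(X)+C_{m-2,2}(q,t)\,s_{(2)}(X),\] where $s_\lambda(X)$ denotes the Schur function.
   Context: For coprime positive integers $a,n$: the $(a,n)$-diagram consists of unit cells $(u,v)$, $1\le u\le a$, $1\le v\le n$, cell $(u,v)$ being the unit square in $[0,a]\times[0,n]$ with northeast corner $(u,v)$, of rank $\gamma(u,v)=an-un-(n+1-v)a$. An $(a,n)$-Dyck path $\pi$ is a lattice path from $(0,0)$ to $(a,n)$ with unit north and east steps never going strictly below $y=\frac{n}{a}x$. Cells northwest of the path are "above the path", the others "below". For each north step, the cell whose western edge is that step is "on the path"; $R(\pi)$ is the set of the $n$ ranks of these cells. $\mathrm{area}(\pi)$ is the number of cells below $\pi$ with positive rank. For a cell $c$ above $\pi$, $\mathrm{arm}(c)$ (resp. $\mathrm{leg}(c)$) counts cells above $\pi$ strictly east of $c$ in its row (resp. strictly south in its column); $c$ is a dinv cell if $\frac{\mathrm{arm}(c)}{\mathrm{leg}(c)+1}<\frac{a}{n}<\frac{\mathrm{arm}(c)+1}{\mathrm{leg}(c)}$ (division by $0$ is $+\infty$); $\mathrm{dinv}(\pi)$ is the number of dinv cells. $C_{a,n}(q,t)=\sum_\pi q^{\mathrm{dinv}(\pi)}t^{\mathrm{area}(\pi)}$ over all $(a,n)$-Dyck paths. An $(m,n)$-parking function is a pair $P=(\pi,W)$, $\pi$ an $(m,n)$-Dyck path, $W=(w_1,\dots,w_n)$ an ordering of $R(\pi)$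 in which $k$ appears left of $k+m$ whenever both lie in $R(\pi)$. $\mathrm{area}(P)=\mathrm{area}(\pi)$, $\mathrm{des}(P)=\{i\in[n-1]:w_i>w_{i+1}\}$, $\mathrm{inv}(P)=\#\{(i,j):i<j,\ w_j<w_i<w_j+m\}$, $\mathrm{dinv}(P)=\mathrm{dinv}(\pi)-\mathrm{inv}(P)$. For $S\subseteq[n-1]$, $F_S(X)=\sum x_{i_1}\cdots x_{i_n}$ over $i_1\le\cdots\le i_n$ with $i_j<i_{j+1}$ whenever $j\notin S$ (so for $n=2$: $F_\emptyset=s_{(1,1)}$, $F_{\{1\}}=s_{(2)}$). The Hikita polynomial is $\mathcal H_{m,n}(X;q,t)=\sum_P t^{\mathrm{area}(P)}q^{\mathrm{dinv}(P)}F_{\mathrm{des}(P)}(X)$ over all $(m,n)$-parking functions. -}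

module Defs where

open import Data.Nat as ℕ using (ℕ; zero; suc; _+_; _*_; _∸_; _≤ᵇ_; _<ᵇ_; _≡ᵇ_)
open import Data.Integer as ℤ using (ℤ; +_)
open import Data.Bool using (Bool; true; false; _∧_; _∨_; not; if_then_else_)
open import Data.List using (List; []; _∷_; [_]; map; _++_; concatMap; length; upTo)
open import Data.Nat.ListAction using (sum)
open import Data.Product using (_×_; _,_; proj₁; proj₂)
open import Relation.Nullary.Decidable using (⌊_⌋)
open import Relation.Binary.PropositionalEquality using (_≡_)

filterB : {A : Set} → (A → Bool) → List A → List A
filterB p [] = []
filterB p (x ∷ xs) = if p x then x ∷ filterB p xs else filterB p xs

countB : {A : Set} → (A → Bool) → List A → ℕ
countB p xs = length (filterB p xs)

allB : {A : Set} → (A → Bool) → List A → Bool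
allB p [] = true
allB p (x ∷ xs) = p x ∧ allB p xs

insertions : {A : Set} → A → List A → List (List A)
insertions x [] = [ x ∷ [] ]
insertions x (y ∷ ys) = (x ∷ y ∷ ys) ∷ map (y ∷_) (insertions x ys)

perms : {A : Set} → List A → List (List A)
perms [] = [ [] ]
perms (x ∷ xs) = concatMap (insertions x) (perms xs)

pairsLR : {A : Set} → List A → List (A × A)
pairsLR [] = []
pairsLR (x ∷ xs) = map (x ,_) xs ++ pairsLR xs

consec : {A : Set} → List A → List (A × A)
consec [] = []
consec (x ∷ []) = []
consec (x ∷ y ∷ ys) = (x , y) ∷ consec (y ∷ ys)

fromLen : ℕ → ℕ → List ℕ
fromLen lo k = map (λ i → lo + i) (upTo k)

-- Lattice paths from (0,0) to (a,n): words in {E = false, N = true}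

words : ℕ → ℕ → List (List Bool)
words zero zero = [ [] ]
words (suc e) zero = map (false ∷_) (words e zero)
words zero (suc k) = map (true ∷_) (words zero k)
words (suc e) (suc k) = map (false ∷_) (words e (suc k)) ++ map (true ∷_) (words (suc e) k)

-- every vertex (x,y) visited satisfies y ≥ (n/a) x, i.e. n*x ≤ a*y
-- (checking vertices suffices since the path is piecewise linear)
notBelow : ℕ → ℕ → ℕ → ℕ → List Bool → Bool
notBelow a n x y [] = (n * x) ≤ᵇ (a * y)
notBelow a n x y (s ∷ w) =
  ((n * x) ≤ᵇ (a * y)) ∧ (if s then notBelow a n x (suc y) w else notBelow a n (suc x) y w)

dyckPaths : ℕ → ℕ → List (List Bool)
dyckPaths a n = filterB (notBelow a n 0 0) (words a n)

northXs : ℕ → List Bool → List ℕ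
northXs x [] = []
northXs x (true ∷ w) = x ∷ northXs x w
northXs x (false ∷ w) = northXs (suc x) w

-- rows: pairs (v , x_v), v = 1..n; the v-th north step goes from (x_v,v-1) to (x_v,v).
-- In row v the cells (u,v) with u ≤ x_v are above the path, those with u > x_v below;
-- the cell on the path is (x_v + 1 , v).
rowsFrom : ℕ → List ℕ → List (ℕ × ℕ)
rowsFrom v [] = []
rowsFrom v (x ∷ xs) = (v , x) ∷ rowsFrom (suc v) xs

rows : List Bool → List (ℕ × ℕ)
rows π = rowsFrom 1 (northXs 0 π)

-- rank γ(u,v) = a n − u n − (n+1−v) a   (v ≤ n always)
rank : ℕ → ℕ → ℕ → ℕ → ℤ
rank a n u v = (+ (a * n) ℤ.- + (u * n)) ℤ.- + ((suc n ∸ v) * a)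

ranksOnPath : ℕ → ℕ → List Bool → List ℤ
ranksOnPath a n π = map (λ r → rank a n (suc (proj₂ r)) (proj₁ r)) (rows π)

areaPath : ℕ → ℕ → List Bool → ℕ
areaPath a n π =
  sum (map (λ r → countB (λ u → ⌊ ℤ.+0 ℤ.<? rank a n u (proj₁ r) ⌋)
                         (fromLen (suc (proj₂ r)) (a ∸ proj₂ r)))
           (rows π))

-- leg of the cell (u,v) above π: cells above π strictly south in column u
legCell : List (ℕ × ℕ) → ℕ → ℕ → ℕ
legCell rs u v = countB (λ r → (proj₁ r <ᵇ v) ∧ (u ≤ᵇ proj₂ r)) rs

-- dinv cell test: arm/(leg+1) < a/n < (arm+1)/leg, with x/0 = +∞
isDinv : ℕ → ℕ → ℕ → ℕ → Bool
isDinv a n arm leg =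
  ((arm * n) <ᵇ (a * suc leg)) ∧ ((leg ≡ᵇ 0) ∨ ((a * leg) <ᵇ (n * suc arm)))

-- dinv(π): cells (u,v), 1 ≤ u ≤ x_v, above π; arm(u,v) = x_v − u
dinvPath : ℕ → ℕ → List Bool → ℕ
dinvPath a n π =
  sum (map (λ r → countB (λ u → isDinv a n (proj₂ r ∸ u) (legCell (rows π) u (proj₁ r)))
                         (fromLen 1 (proj₂ r)))
           (rows π))

-- Formal series: a finite list of terms, each term = (S , i , j) meaning
-- q^i t^j F_S (S a descent set ⊆ [n-1] encoded by its indicator list
-- of length n-1), all with coefficient 1; two series are equal when all
-- their coefficients agree.  For polynomials in q,t alone a term is (i , j).

Mono : Set
Mono = ℤ × ℕ          -- q^i t^j

Term : Set
Term = List Bool × Mono   -- q^i t^j F_S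

coeff : List Term → List Bool → ℤ → ℕ → ℕ
coeff L S i j = countB (λ τ → eqS (proj₁ τ) S ∧ ⌊ proj₁ (proj₂ τ) ℤ.≟ i ⌋ ∧ (proj₂ (proj₂ τ) ≡ᵇ j)) L
  where
  eqB : Bool → Bool → Bool
  eqB true b = b
  eqB false b = not b
  eqS : List Bool → List Bool → Bool
  eqS [] [] = true
  eqS (x ∷ xs) (y ∷ ys) = eqB x y ∧ eqS xs ys
  eqS _ _ = false

_≋_ : List Term → List Term → Set
L ≋ L' = ∀ S i j → coeff L S i j ≡ coeff L' S i j

_·F_ : List Mono → List Bool → List Term
P ·F S = map (S ,_) P

C : ℕ → ℕ → List Mono
C a n = map (λ π → (+ dinvPath a n π , areaPath a n π)) (dyckPaths a n)

-- W is admissible: k appears left of k+m whenever both occur,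
-- i.e. there is no i < j with w_i = w_j + m
admissible : ℕ → List ℤ → Bool
admissible m W = allB (λ p → not ⌊ proj₁ p ℤ.≟ proj₂ p ℤ.+ + m ⌋) (pairsLR W)

invW : ℕ → List ℤ → ℕ
invW m W = countB (λ p → ⌊ proj₂ p ℤ.<? proj₁ p ⌋ ∧ ⌊ proj₁ p ℤ.<? proj₂ p ℤ.+ + m ⌋) (pairsLR W)

desW : List ℤ → List Bool
desW W = map (λ p → ⌊ proj₂ p ℤ.<? proj₁ p ⌋) (consec W)

parkingFunctions : ℕ → ℕ → List (List Bool × List ℤ)
parkingFunctions m n =
  concatMap (λ π → map (π ,_) (filterB (admissible m) (perms (ranksOnPath m n π))))
            (dyckPaths m n)

hikita : ℕ → ℕ → List Term
hikita m n =
  map (λ P → (desW (proj₂ P) ,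
              (+ dinvPath m n (proj₁ P) ℤ.- + invW m (proj₂ P) , areaPath m n (proj₁ P))))
      (parkingFunctions m n)

-- For n = 2: s_(1,1) = F_∅ and s_(2) = F_{1}
F∅ : List Bool
F∅ = false ∷ []

F₁ : List Bool
F₁ = true ∷ []

_·s₁₁ : List Mono → List Term
P ·s₁₁ = P ·F F∅

_·s₂ : List Mono → List Term
P ·s₂ = P ·F F₁

module Submission where

-- For odd m = 2p+1 ≥ 3 the (m,2)-Dyck paths are the words N E^j N E^(m-j),
-- 0 ≤ j ≤ p; such a path has dinv j and area p-j, so C_{m,2} = Σ_j q^j t^(p-j).
-- Its two cells have ranks -2 < 2(p-j)-1, so its parking functions are the
-- word (-2, 2(p-j)-1), giving q^j t^(p-j) F_∅, and for j ≥ 1 the reversed word,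
-- giving q^(j-1) t^(p-j) F_{1} (for j = 0 the reversed word violates the
-- admissibility rule, since 2p-1 = -2 + m).  The F_{1} terms are those of
-- C_{m-2,2}.  Since series are compared coefficientwise, it suffices to show
-- that the Hikita term list is a permutation of the right-hand side.

open import Defs
open import Data.Nat using (ℕ; _≤_; _∸_; _%_)
open import Data.List using (_++_)
open import Relation.Binary.PropositionalEquality using (_≡_)

open import Data.Nat using (zero; suc; _+_; _*_; _<_; _<ᵇ_; _≤ᵇ_; z≤n; s≤s; _/_)
import Data.Nat.Properties as ℕP
import Data.Bool.Properties as BP
open import Data.Nat.DivMod using (m≡m%n+[m/n]*n)
open import Data.Integer as ℤ using (ℤ; +_; -[1+_]; _⊖_; +<+; -<+; -<-)
import Data.Integer.Properties as ℤP
open import Data.Integer.Tactic.RingSolver using (solve-∀)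
open import Data.List using (List; []; _∷_; [_]; map; concatMap; length; concat; applyUpTo; downFrom; replicate)
import Data.List.Properties as LP
open import Data.List.Relation.Unary.All using (All)
open import Data.List.Relation.Unary.All.Properties using (applyDownFrom⁺₁)
open import Data.List.Relation.Binary.Permutation.Propositional using (_↭_; refl; prep; swap; trans)
open import Data.List.Relation.Binary.Permutation.Propositional.Properties using (++⁺ˡ; shifts)
open import Data.Nat.ListAction using (sum)
open import Data.Bool using (Bool; true; false; _∧_; not; if_then_else_; T)
open import Data.Product using (_×_; _,_; proj₁; proj₂; ∃-syntax)
open import Data.Sum using (inj₁; inj₂)
open import Data.Empty using (⊥-elim)
open import Data.Unit using (tt)
open import Function using (_∘_)
open import Relation.Nullary using (¬_; Dec)
open import Relation.Nullary.Decidable using (⌊_⌋; fromWitness; toWitness)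
open import Relation.Binary.PropositionalEquality
  using (cong; cong₂; sym; subst; subst₂; module ≡-Reasoning)
  renaming (refl to ≡-refl; trans to ≡-trans)
open ≡-Reasoning

T-ext : {b c : Bool} → (T b → T c) → (T c → T b) → b ≡ c
T-ext {false} {false} _ _ = ≡-refl
T-ext {false} {true}  _ g = ⊥-elim (g tt)
T-ext {true}  {false} f _ = ⊥-elim (f tt)
T-ext {true}  {true}  _ _ = ≡-refl

⌊⌋-yes : {P : Set} {d : Dec P} → P → ⌊ d ⌋ ≡ true
⌊⌋-yes p = T-ext (λ _ → tt) (λ _ → fromWitness p)

⌊⌋-no : {P : Set} {d : Dec P} → ¬ P → ⌊ d ⌋ ≡ false
⌊⌋-no ¬p = T-ext (λ t → ¬p (toWitness t)) (λ ())

∧-absorbˡ : {b c d : Bool} → (T c → T b) → b ∧ (c ∧ d) ≡ c ∧ d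
∧-absorbˡ {b} {false} _ = BP.∧-zeroʳ b
∧-absorbˡ {true}  {true} _ = ≡-refl
∧-absorbˡ {false} {true} f = ⊥-elim (f tt)

∧-redundantʳ : {b c : Bool} → (T b → c ≡ true) → b ∧ c ≡ b
∧-redundantʳ {false} _ = ≡-refl
∧-redundantʳ {true}  f = f tt

module _ {A : Set} where

  filterB-accept : (p : A → Bool) (x : A) (xs : List A) → p x ≡ true →
                   filterB p (x ∷ xs) ≡ x ∷ filterB p xs
  filterB-accept p x xs px with p x
  ... | true = ≡-refl

  filterB-reject : (p : A → Bool) (x : A) (xs : List A) → p x ≡ false →
                   filterB p (x ∷ xs) ≡ filterB p xs
  filterB-reject p x xs px with p x
  ... | false = ≡-refl

  filterB-++ : (p : A → Bool) (xs ys : List A) →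
               filterB p (xs ++ ys) ≡ filterB p xs ++ filterB p ys
  filterB-++ p [] ys = ≡-refl
  filterB-++ p (x ∷ xs) ys with p x
  ... | true  = cong (x ∷_) (filterB-++ p xs ys)
  ... | false = filterB-++ p xs ys

  filterB-cong : {p q : A → Bool} → (∀ x → p x ≡ q x) → ∀ xs → filterB p xs ≡ filterB q xs
  filterB-cong e [] = ≡-refl
  filterB-cong {p} {q} e (x ∷ xs) with p x | q x | e x
  ... | true  | .true  | ≡-refl = cong (x ∷_) (filterB-cong e xs)
  ... | false | .false | ≡-refl = filterB-cong e xs

  filterB-map : {B : Set} (p : A → Bool) (f : B → A) (xs : List B) →
                filterB p (map f xs) ≡ map f (filterB (p ∘ f) xs)
  filterB-map p f [] = ≡-refl
  filterB-map p f (x ∷ xs) with p (f x)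
  ... | true  = cong (f x ∷_) (filterB-map p f xs)
  ... | false = filterB-map p f xs

  filterB-all : {p : A → Bool} {xs : List A} → All (λ x → p x ≡ true) xs → filterB p xs ≡ xs
  filterB-all {p} {x ∷ xs} (px All.∷ pxs) =
    ≡-trans (filterB-accept p x xs px) (cong (x ∷_) (filterB-all pxs))
  filterB-all All.[] = ≡-refl

  filterB-none : {p : A → Bool} → (∀ x → p x ≡ false) → ∀ xs → filterB p xs ≡ []
  filterB-none e [] = ≡-refl
  filterB-none {p} e (x ∷ xs) = ≡-trans (filterB-reject p x xs (e x)) (filterB-none e xs)

  countB-↭ : (p : A → Bool) {xs ys : List A} → xs ↭ ys → countB p xs ≡ countB p ys
  countB-↭ p refl = ≡-refl
  countB-↭ p (prep x σ) with p x
  ... | true  = cong suc (countB-↭ p σ)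
  ... | false = countB-↭ p σ
  countB-↭ p (swap x y σ) with p x | p y
  ... | true  | true  = cong (suc ∘ suc) (countB-↭ p σ)
  ... | true  | false = cong suc (countB-↭ p σ)
  ... | false | true  = cong suc (countB-↭ p σ)
  ... | false | false = countB-↭ p σ
  countB-↭ p (trans σ τ) = ≡-trans (countB-↭ p σ) (countB-↭ p τ)

  countB-threshold : (Q : A → Bool) (f : ℕ → A) {k n : ℕ} → k ≤ n →
    (∀ i → i < n → Q (f i) ≡ (i <ᵇ k)) → countB Q (applyUpTo f n) ≡ k
  countB-threshold Q f {n = zero} z≤n _ = ≡-refl
  countB-threshold Q f {zero} {suc n} z≤n e =
    ≡-trans (cong length (filterB-reject Q (f 0) (applyUpTo (f ∘ suc) n) (e 0 (s≤s z≤n))))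
            (countB-threshold Q (f ∘ suc) z≤n (λ i i<n → e (suc i) (s≤s i<n)))
  countB-threshold Q f {suc k} {suc n} (s≤s k≤n) e =
    ≡-trans (cong length (filterB-accept Q (f 0) (applyUpTo (f ∘ suc) n) (e 0 (s≤s z≤n))))
            (cong suc (countB-threshold Q (f ∘ suc) k≤n (λ i i<n → e (suc i) (s≤s i<n))))

↭⇒≋ : {L L' : List Term} → L ↭ L' → L ≋ L'
↭⇒≋ σ S i j = countB-↭ _ σ

module _ {A : Set} where

  concatMap-∷-↭ : (f : ℕ → A) (g : ℕ → List A) (xs : List ℕ) →
    concatMap (λ x → f x ∷ g x) xs ↭ map f xs ++ concatMap g xs
  concatMap-∷-↭ f g [] = refl
  concatMap-∷-↭ f g (x ∷ xs) =
    prep (f x) (trans (++⁺ˡ (g x) (concatMap-∷-↭ f g xs)) (shifts (g x) (map f xs)))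

  atPred : (ℕ → A) → ℕ → List A
  atPred h zero    = []
  atPred h (suc k) = [ h k ]

  concatMap-atPred : (h : ℕ → A) (n : ℕ) → concatMap (atPred h) (downFrom (suc n)) ≡ map h (downFrom n)
  concatMap-atPred h zero    = ≡-refl
  concatMap-atPred h (suc n) = cong (h n ∷_) (concatMap-atPred h n)

  map-downFrom-cong : {f g : ℕ → A} (n : ℕ) → (∀ j → j < n → f j ≡ g j) →
    map f (downFrom n) ≡ map g (downFrom n)
  map-downFrom-cong n e = LP.map-cong-local (applyDownFrom⁺₁ (λ j → j) n (e _))

  map-applyUpTo : {B : Set} (f : B → A) (g : ℕ → B) (n : ℕ) →
    map f (applyUpTo g n) ≡ applyUpTo (f ∘ g) n
  map-applyUpTo f g zero    = ≡-refl
  map-applyUpTo f g (suc n) = cong (f (g 0) ∷_) (map-applyUpTo f (g ∘ suc) n)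

fromLen-applyUpTo : (lo n : ℕ) → fromLen lo n ≡ applyUpTo (λ i → lo + i) n
fromLen-applyUpTo lo n = map-applyUpTo (λ i → lo + i) (λ i → i) n

downFrom-suc : (n : ℕ) → downFrom (suc n) ≡ map suc (downFrom n) ++ [ 0 ]
downFrom-suc n = sym (≡-trans (cong (_++ [ 0 ]) (LP.map-downFrom suc n)) (LP.downFrom-∷ʳ n))

filter-downFrom : {k n : ℕ} → k ≤ n → filterB (_<ᵇ k) (downFrom n) ≡ downFrom k
filter-downFrom {k} {zero} z≤n = ≡-refl
filter-downFrom {k} {suc n} k≤1+n with ℕP.m≤n⇒m<n∨m≡n k≤1+n
... | inj₁ (s≤s k≤n) =
  ≡-trans (filterB-reject (_<ᵇ k) n (downFrom n)
             (T-ext (λ t → ⊥-elim (ℕP.<⇒≱ (ℕP.<ᵇ⇒< n k t) k≤n)) (λ ())))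
          (filter-downFrom k≤n)
... | inj₂ ≡-refl =
  ≡-trans (filterB-accept (_<ᵇ suc n) n (downFrom n)
             (T-ext (λ _ → tt) (λ _ → ℕP.<⇒<ᵇ (ℕP.n<1+n n))))
          (cong (n ∷_) (filterB-all (applyDownFrom⁺₁ (λ j → j) n
            (λ j<n → T-ext (λ _ → tt) (λ _ → ℕP.<⇒<ᵇ (ℕP.m≤n⇒m≤1+n j<n))))))

oneNorth : ℕ → ℕ → List Bool
oneNorth e j = replicate j false ++ true ∷ replicate (e ∸ j) false

words-noNorth : (e : ℕ) → words e 0 ≡ [ replicate e false ]
words-noNorth zero    = ≡-refl
words-noNorth (suc e) = cong (map (false ∷_)) (words-noNorth e)

words-oneNorth : (e : ℕ) → words e 1 ≡ map (oneNorth e) (downFrom (suc e))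
words-oneNorth zero    = ≡-refl
words-oneNorth (suc e) = begin
  map (false ∷_) (words e 1) ++ map (true ∷_) (words (suc e) 0)
    ≡⟨ cong₂ (λ xs ys → map (false ∷_) xs ++ map (true ∷_) ys)
             (words-oneNorth e) (words-noNorth (suc e)) ⟩
  map (false ∷_) (map (oneNorth e) (downFrom (suc e))) ++ [ oneNorth (suc e) 0 ]
    ≡⟨ cong (_++ [ oneNorth (suc e) 0 ]) (sym (LP.map-∘ (downFrom (suc e)))) ⟩
  map (oneNorth (suc e) ∘ suc) (downFrom (suc e)) ++ [ oneNorth (suc e) 0 ]
    ≡⟨ cong (_++ [ oneNorth (suc e) 0 ]) (LP.map-∘ (downFrom (suc e))) ⟩
  map (oneNorth (suc e)) (map suc (downFrom (suc e))) ++ map (oneNorth (suc e)) [ 0 ]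
    ≡⟨ sym (LP.map-++ (oneNorth (suc e)) (map suc (downFrom (suc e))) [ 0 ]) ⟩
  map (oneNorth (suc e)) (map suc (downFrom (suc e)) ++ [ 0 ])
    ≡⟨ cong (map (oneNorth (suc e))) (sym (downFrom-suc (suc e))) ⟩
  map (oneNorth (suc e)) (downFrom (suc (suc e))) ∎

northXs-east : (x j : ℕ) (w : List Bool) → northXs x (replicate j false ++ w) ≡ northXs (j + x) w
northXs-east x zero    w = ≡-refl
northXs-east x (suc j) w = ≡-trans (northXs-east (suc x) j w) (cong (λ z → northXs z w) (ℕP.+-suc j x))

northXs-oneNorth : (e j : ℕ) → northXs 0 (oneNorth e j) ≡ [ j ]
northXs-oneNorth e j =
  ≡-trans (northXs-east 0 j (true ∷ replicate (e ∸ j) false))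
          (cong₂ _∷_ (ℕP.+-identityʳ j) (noNorth (j + 0) (e ∸ j)))
  where
  noNorth : (x r : ℕ) → northXs x (replicate r false) ≡ []
  noNorth x zero    = ≡-refl
  noNorth x (suc r) = noNorth (suc x) r

twoRowPath : ℕ → ℕ → List Bool
twoRowPath a j = true ∷ oneNorth a j

rows-twoRowPath : (a j : ℕ) → rows (twoRowPath a j) ≡ (1 , 0) ∷ (2 , j) ∷ []
rows-twoRowPath a j = cong (λ xs → rowsFrom 1 (0 ∷ xs)) (northXs-oneNorth a j)

-- A path starting with an east step passes below the diagonal at (1,0).
notBelow-eastStart : (a : ℕ) (w : List Bool) → notBelow a 2 0 0 (false ∷ w) ≡ false
notBelow-eastStart a [] = cong (2 ≤ᵇ_) (ℕP.*-zeroʳ a)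
notBelow-eastStart a (s ∷ w) =
  cong (λ b → b ∧ (if s then notBelow a 2 1 1 w else notBelow a 2 2 0 w)) (cong (2 ≤ᵇ_) (ℕP.*-zeroʳ a))

notBelow-row2 : (a x r : ℕ) → x + r ≤ a → notBelow a 2 x 2 (replicate r false) ≡ true
notBelow-row2 a x zero    x+r≤a = vertexOK (ℕP.≤-trans (ℕP.m≤m+n x 0) x+r≤a)
  where
  vertexOK : {x : ℕ} → x ≤ a → (2 * x ≤ᵇ a * 2) ≡ true
  vertexOK {x} x≤a = T-ext (λ _ → tt) (λ _ → ℕP.≤⇒≤ᵇ
    (subst (_≤ a * 2) (ℕP.*-comm x 2) (ℕP.*-monoˡ-≤ 2 x≤a)))
notBelow-row2 a x (suc r) x+r≤a = cong₂ _∧_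
  (notBelow-row2 a x zero (ℕP.≤-trans (ℕP.+-monoʳ-≤ x z≤n) x+r≤a))
  (notBelow-row2 a (suc x) r (subst (_≤ a) (ℕP.+-suc x r) x+r≤a))

-- On the line y = 1 the east run E^j ending at x+j stays above the diagonal
-- iff its last vertex does, i.e. iff 2(x+j) ≤ a.
notBelow-row1 : (a x j : ℕ) (w : List Bool) →
  notBelow a 2 x 1 (replicate j false ++ true ∷ w) ≡ (2 * (j + x) ≤ᵇ a * 1) ∧ notBelow a 2 (j + x) 2 w
notBelow-row1 a x zero    w = ≡-refl
notBelow-row1 a x (suc j) w = begin
  (2 * x ≤ᵇ a * 1) ∧ notBelow a 2 (suc x) 1 (replicate j false ++ true ∷ w)
    ≡⟨ cong ((2 * x ≤ᵇ a * 1) ∧_) (notBelow-row1 a (suc x) j w) ⟩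
  (2 * x ≤ᵇ a * 1) ∧ ((2 * (j + suc x) ≤ᵇ a * 1) ∧ notBelow a 2 (j + suc x) 2 w)
    ≡⟨ ∧-absorbˡ (λ t → ℕP.≤⇒≤ᵇ (ℕP.≤-trans 2x≤2[j+1+x] (ℕP.≤ᵇ⇒≤ _ _ t))) ⟩
  (2 * (j + suc x) ≤ᵇ a * 1) ∧ notBelow a 2 (j + suc x) 2 w
    ≡⟨ cong (λ z → (2 * z ≤ᵇ a * 1) ∧ notBelow a 2 z 2 w) (ℕP.+-suc j x) ⟩
  (2 * suc (j + x) ≤ᵇ a * 1) ∧ notBelow a 2 (suc (j + x)) 2 w ∎
  where
  2x≤2[j+1+x] : 2 * x ≤ 2 * (j + suc x)
  2x≤2[j+1+x] = ℕP.*-monoʳ-≤ 2 (ℕP.≤-trans (ℕP.n≤1+n x) (ℕP.m≤n+m (suc x) j))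

notBelow-twoRowPath : (a j : ℕ) → notBelow a 2 0 0 (twoRowPath a j) ≡ (2 * j ≤ᵇ a)
notBelow-twoRowPath a j = begin
  notBelow a 2 0 1 (oneNorth a j)
    ≡⟨ notBelow-row1 a 0 j _ ⟩
  (2 * (j + 0) ≤ᵇ a * 1) ∧ notBelow a 2 (j + 0) 2 (replicate (a ∸ j) false)
    ≡⟨ cong₂ (λ z b → (2 * z ≤ᵇ b) ∧ notBelow a 2 z 2 (replicate (a ∸ j) false))
             (ℕP.+-identityʳ j) (ℕP.*-identityʳ a) ⟩
  (2 * j ≤ᵇ a) ∧ notBelow a 2 j 2 (replicate (a ∸ j) false)
    ≡⟨ ∧-redundantʳ (λ t → notBelow-row2 a j (a ∸ j)
         (ℕP.≤-reflexive (ℕP.m+[n∸m]≡n (ℕP.≤-trans (ℕP.m≤m+n j (j + 0)) (ℕP.≤ᵇ⇒≤ _ _ t))))) ⟩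
  (2 * j ≤ᵇ a) ∎

dyckPaths-two : (a : ℕ) → dyckPaths (suc a) 2 ≡
  map (twoRowPath (suc a)) (filterB (λ j → 2 * j ≤ᵇ suc a) (downFrom (suc (suc a))))
dyckPaths-two a = begin
  filterB nb (map (false ∷_) (words a 2) ++ map (true ∷_) (words (suc a) 1))
    ≡⟨ filterB-++ nb (map (false ∷_) (words a 2)) _ ⟩
  filterB nb (map (false ∷_) (words a 2)) ++ filterB nb (map (true ∷_) (words (suc a) 1))
    ≡⟨ cong₂ _++_ eastStart northStart ⟩
  map (twoRowPath (suc a)) (filterB (λ j → 2 * j ≤ᵇ suc a) (downFrom (suc (suc a)))) ∎
  where
  nb : List Bool → Bool
  nb = notBelow (suc a) 2 0 0
  eastStart : filterB nb (map (false ∷_) (words a 2)) ≡ []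
  eastStart = ≡-trans (filterB-map nb (false ∷_) (words a 2))
                      (cong (map (false ∷_)) (filterB-none (notBelow-eastStart (suc a)) (words a 2)))
  northStart : filterB nb (map (true ∷_) (words (suc a) 1)) ≡
               map (twoRowPath (suc a)) (filterB (λ j → 2 * j ≤ᵇ suc a) (downFrom (suc (suc a))))
  northStart = begin
    filterB nb (map (true ∷_) (words (suc a) 1))
      ≡⟨ cong (λ ws → filterB nb (map (true ∷_) ws)) (words-oneNorth (suc a)) ⟩
    filterB nb (map (true ∷_) (map (oneNorth (suc a)) (downFrom (suc (suc a)))))
      ≡⟨ cong (filterB nb) (sym (LP.map-∘ {g = true ∷_} {f = oneNorth (suc a)} (downFrom (suc (suc a))))) ⟩
    filterB nb (map (twoRowPath (suc a)) (downFrom (suc (suc a))))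
      ≡⟨ filterB-map nb (twoRowPath (suc a)) (downFrom (suc (suc a))) ⟩
    map (twoRowPath (suc a)) (filterB (nb ∘ twoRowPath (suc a)) (downFrom (suc (suc a))))
      ≡⟨ cong (map (twoRowPath (suc a))) (filterB-cong (notBelow-twoRowPath (suc a)) (downFrom (suc (suc a)))) ⟩
    map (twoRowPath (suc a)) (filterB (λ j → 2 * j ≤ᵇ suc a) (downFrom (suc (suc a)))) ∎

rank-row1 : (a u : ℕ) → rank a 2 u 1 ≡ ℤ.- (+ (u * 2))
rank-row1 a u = begin
  (+ (a * 2) ℤ.- + (u * 2)) ℤ.- + (2 * a)
    ≡⟨ cong₂ (λ x y → (x ℤ.- + (u * 2)) ℤ.- y) (ℤP.pos-* a 2) (ℤP.pos-* 2 a) ⟩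
  (+ a ℤ.* + 2 ℤ.- + (u * 2)) ℤ.- + 2 ℤ.* + a
    ≡⟨ cancel (+ a) (+ (u * 2)) ⟩
  ℤ.- (+ (u * 2)) ∎
  where
  cancel : ∀ x y → (x ℤ.* + 2 ℤ.- y) ℤ.- + 2 ℤ.* x ≡ ℤ.- y
  cancel = solve-∀

rank-row2 : (a u : ℕ) → rank a 2 u 2 ≡ a ⊖ (u * 2)
rank-row2 a u = begin
  (+ (a * 2) ℤ.- + (u * 2)) ℤ.- + (1 * a)
    ≡⟨ cong₂ (λ x y → (x ℤ.- + (u * 2)) ℤ.- + y) (ℤP.pos-* a 2) (ℕP.*-identityˡ a) ⟩
  (+ a ℤ.* + 2 ℤ.- + (u * 2)) ℤ.- + a
    ≡⟨ cancel (+ a) (+ (u * 2)) ⟩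
  + a ℤ.- + (u * 2)
    ≡⟨ ℤP.m-n≡m⊖n a (u * 2) ⟩
  a ⊖ (u * 2) ∎
  where
  cancel : ∀ x y → (x ℤ.* + 2 ℤ.- y) ℤ.- x ≡ x ℤ.- y
  cancel = solve-∀

isPositive : ℤ → Bool
isPositive r = ⌊ ℤ.+0 ℤ.<? r ⌋

isPositive-neg : (n : ℕ) → isPositive (ℤ.- (+ n)) ≡ false
isPositive-neg zero    = ≡-refl
isPositive-neg (suc n) = ≡-refl

isPositive-⊖ : (m n : ℕ) → isPositive (m ⊖ n) ≡ (n <ᵇ m)
isPositive-⊖ zero    zero    = ≡-refl
isPositive-⊖ zero    (suc n) = ≡-refl
isPositive-⊖ (suc m) zero    = ≡-refl
isPositive-⊖ (suc m) (suc n) = ≡-trans (cong isPositive (ℤP.[1+m]⊖[1+n]≡m⊖n m n)) (isPositive-⊖ m n)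

dinvOfRows : ℕ → ℕ → List (ℕ × ℕ) → ℕ
dinvOfRows a n R =
  sum (map (λ r → countB (λ u → isDinv a n (proj₂ r ∸ u) (legCell R u (proj₁ r)))
                         (fromLen 1 (proj₂ r))) R)

areaOfRows : ℕ → ℕ → List (ℕ × ℕ) → ℕ
areaOfRows a n R =
  sum (map (λ r → countB (λ u → isPositive (rank a n u (proj₁ r)))
                         (fromLen (suc (proj₂ r)) (a ∸ proj₂ r))) R)

-- Every cell above N E^j N E^(a-j) lies in row 2, has leg 0 and arm < j;
-- when 2j ≤ a all j of them are dinv cells.
dinv-twoRowPath : (a j : ℕ) → 2 * j ≤ a → dinvPath a 2 (twoRowPath a j) ≡ j
dinv-twoRowPath a j 2j≤a = begin
  dinvOfRows a 2 (rows (twoRowPath a j))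
    ≡⟨ cong (dinvOfRows a 2) (rows-twoRowPath a j) ⟩
  countB isDinvCell (fromLen 1 j) + 0
    ≡⟨ ℕP.+-identityʳ _ ⟩
  countB isDinvCell (fromLen 1 j)
    ≡⟨ cong (countB isDinvCell) (fromLen-applyUpTo 1 j) ⟩
  countB isDinvCell (applyUpTo suc j)
    ≡⟨ countB-threshold isDinvCell suc ℕP.≤-refl allDinv ⟩
  j ∎
  where
  isDinvCell : ℕ → Bool
  isDinvCell u = isDinv a 2 (j ∸ u) (legCell ((1 , 0) ∷ (2 , j) ∷ []) u 2)
  armBound : ∀ i → i < j → (j ∸ suc i) * 2 < a * 1
  armBound i i<j = ℕP.<-≤-trans (ℕP.*-monoˡ-< 2 (ℕP.∸-monoʳ-< {j} (s≤s z≤n) i<j))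
                     (subst₂ _≤_ (ℕP.*-comm 2 j) (sym (ℕP.*-identityʳ a)) 2j≤a)
  allDinv : ∀ i → i < j → isDinvCell (suc i) ≡ (i <ᵇ j)
  allDinv i i<j = ≡-trans (BP.∧-identityʳ _)
    (T-ext (λ _ → ℕP.<⇒<ᵇ i<j) (λ _ → ℕP.<⇒<ᵇ (armBound i i<j)))

double-<ᵇ : (u v : ℕ) → (u * 2 <ᵇ v * 2) ≡ (u <ᵇ v)
double-<ᵇ zero    zero    = ≡-refl
double-<ᵇ zero    (suc v) = ≡-refl
double-<ᵇ (suc u) zero    = ≡-refl
double-<ᵇ (suc u) (suc v) = double-<ᵇ u v

odd-≤ᵇ : (p u : ℕ) → (u * 2 ≤ᵇ suc (p * 2)) ≡ (u <ᵇ suc p)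
odd-≤ᵇ p zero    = ≡-refl
odd-≤ᵇ p (suc u) = double-<ᵇ u p

odd-<ᵇ : (p u : ℕ) → (u * 2 <ᵇ suc (p * 2)) ≡ (u <ᵇ suc p)
odd-<ᵇ p       zero    = ≡-refl
odd-<ᵇ zero    (suc u) = ≡-refl
odd-<ᵇ (suc p) (suc u) = odd-<ᵇ p u

+-<ᵇ-∸ : (j i p : ℕ) → (j + i <ᵇ p) ≡ (i <ᵇ p ∸ j)
+-<ᵇ-∸ zero    i p       = ≡-refl
+-<ᵇ-∸ (suc j) i zero    = ≡-refl
+-<ᵇ-∸ (suc j) i (suc p) = +-<ᵇ-∸ j i p

-- 2d - 1, the rank of the second cell on a path of width 2p+1 at distance d = p - j.
twiceMinus1 : ℕ → ℤ
twiceMinus1 zero    = -[1+ 0 ]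
twiceMinus1 (suc d) = + suc (d * 2)

twiceMinus1-⊖ : (j d : ℕ) → suc ((j + d) * 2) ⊖ (suc j * 2) ≡ twiceMinus1 d
twiceMinus1-⊖ zero    zero    = ≡-refl
twiceMinus1-⊖ zero    (suc d) = ≡-refl
twiceMinus1-⊖ (suc j) d =
  ≡-trans (ℤP.[1+m]⊖[1+n]≡m⊖n (suc (suc ((j + d) * 2))) (suc (suc (suc (j * 2)))))
    (≡-trans (ℤP.[1+m]⊖[1+n]≡m⊖n (suc ((j + d) * 2)) (suc (suc (j * 2)))) (twiceMinus1-⊖ j d))

module OddWidth (p : ℕ) where

  M : ℕ
  M = suc (p * 2)

  dyckPaths-odd : dyckPaths M 2 ≡ map (twoRowPath M) (downFrom (suc p))
  dyckPaths-odd = ≡-trans (dyckPaths-two (p * 2))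
    (cong (map (twoRowPath M))
      (≡-trans (filterB-cong fits (downFrom (suc M)))
               (filter-downFrom (s≤s (ℕP.m≤n⇒m≤1+n (ℕP.m≤m*n p 2))))))
    where
    fits : ∀ j → (2 * j ≤ᵇ M) ≡ (j <ᵇ suc p)
    fits j = ≡-trans (cong (_≤ᵇ M) (ℕP.*-comm 2 j)) (odd-≤ᵇ p j)

  dinv-odd : (j : ℕ) → j ≤ p → dinvPath M 2 (twoRowPath M j) ≡ j
  dinv-odd j j≤p = dinv-twoRowPath M j
    (ℕP.≤-trans (ℕP.≤-reflexive (ℕP.*-comm 2 j)) (ℕP.m≤n⇒m≤1+n (ℕP.*-monoˡ-≤ 2 j≤p)))

  -- Row 1 has no positive cells; in row 2 the cells below the path with
  -- positive rank are (u,2) with j < u ≤ p.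
  area-odd : (j : ℕ) → areaPath M 2 (twoRowPath M j) ≡ p ∸ j
  area-odd j = begin
    areaOfRows M 2 (rows (twoRowPath M j))
      ≡⟨ cong (areaOfRows M 2) (rows-twoRowPath M j) ⟩
    countB positive1 (fromLen 1 M) + (countB positive2 (fromLen (suc j) (M ∸ j)) + 0)
      ≡⟨ cong₂ (λ x y → countB positive1 x + y) (fromLen-applyUpTo 1 M) (ℕP.+-identityʳ _) ⟩
    countB positive1 (applyUpTo suc M) + countB positive2 (fromLen (suc j) (M ∸ j))
      ≡⟨ cong₂ _+_ (countB-threshold positive1 suc {n = M} z≤n (λ i _ → noneRow1 i))
                   (≡-trans (cong (countB positive2) (fromLen-applyUpTo (suc j) (M ∸ j)))
                            (countB-threshold positive2 (λ i → suc j + i)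
                               (ℕP.∸-monoˡ-≤ j (ℕP.m≤n⇒m≤1+n (ℕP.m≤m*n p 2)))
                               (λ i _ → thresholdRow2 i))) ⟩
    p ∸ j ∎
    where
    positive1 positive2 : ℕ → Bool
    positive1 u = isPositive (rank M 2 u 1)
    positive2 u = isPositive (rank M 2 u 2)
    noneRow1 : ∀ i → positive1 (suc i) ≡ false
    noneRow1 i = ≡-trans (cong isPositive (rank-row1 M (suc i))) (isPositive-neg (suc i * 2))
    thresholdRow2 : ∀ i → positive2 (suc j + i) ≡ (i <ᵇ p ∸ j)
    thresholdRow2 i = begin
      isPositive (rank M 2 (suc j + i) 2) ≡⟨ cong isPositive (rank-row2 M (suc j + i)) ⟩
      isPositive (M ⊖ ((suc j + i) * 2)) ≡⟨ isPositive-⊖ M ((suc j + i) * 2) ⟩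
      ((suc j + i) * 2 <ᵇ M)             ≡⟨ odd-<ᵇ p (suc j + i) ⟩
      (j + i <ᵇ p)                       ≡⟨ +-<ᵇ-∸ j i p ⟩
      (i <ᵇ p ∸ j)                       ∎

  C-odd : C M 2 ≡ map (λ j → (+ j , p ∸ j)) (downFrom (suc p))
  C-odd = begin
    map stats (dyckPaths M 2)
      ≡⟨ cong (map stats) dyckPaths-odd ⟩
    map stats (map (twoRowPath M) (downFrom (suc p)))
      ≡⟨ sym (LP.map-∘ (downFrom (suc p))) ⟩
    map (stats ∘ twoRowPath M) (downFrom (suc p))
      ≡⟨ map-downFrom-cong (suc p) (λ j j<1+p →
           cong₂ (λ d ar → (+ d , ar)) (dinv-odd j (ℕP.≤-pred j<1+p)) (area-odd j)) ⟩
    map (λ j → (+ j , p ∸ j)) (downFrom (suc p)) ∎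
    where
    stats : List Bool → Mono
    stats π = (+ dinvPath M 2 π , areaPath M 2 π)

  ranks-odd : (j : ℕ) → j ≤ p → ranksOnPath M 2 (twoRowPath M j) ≡ -[1+ 1 ] ∷ twiceMinus1 (p ∸ j) ∷ []
  ranks-odd j j≤p = begin
    map (λ r → rank M 2 (suc (proj₂ r)) (proj₁ r)) (rows (twoRowPath M j))
      ≡⟨ cong (map (λ r → rank M 2 (suc (proj₂ r)) (proj₁ r))) (rows-twoRowPath M j) ⟩
    rank M 2 1 1 ∷ rank M 2 (suc j) 2 ∷ []
      ≡⟨ cong₂ (λ x y → x ∷ y ∷ []) (rank-row1 M 1) (rank-row2 M (suc j)) ⟩
    -[1+ 1 ] ∷ M ⊖ (suc j * 2) ∷ []
      ≡⟨ cong (λ y → -[1+ 1 ] ∷ y ∷ []) secondRank ⟩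
    -[1+ 1 ] ∷ twiceMinus1 (p ∸ j) ∷ [] ∎
    where
    secondRank : M ⊖ (suc j * 2) ≡ twiceMinus1 (p ∸ j)
    secondRank = subst (λ q → suc (q * 2) ⊖ (suc j * 2) ≡ twiceMinus1 (p ∸ j))
                       (ℕP.m+[n∸m]≡n j≤p) (twiceMinus1-⊖ j (p ∸ j))

isInversion : ℕ → ℤ × ℤ → Bool
isInversion m q = ⌊ proj₂ q ℤ.<? proj₁ q ⌋ ∧ ⌊ proj₁ q ℤ.<? proj₂ q ℤ.+ + m ⌋

hikitaTerm : ℕ → ℕ → List Bool × List ℤ → Term
hikitaTerm m n P =
  (desW (proj₂ P) , (+ dinvPath m n (proj₁ P) ℤ.- + invW m (proj₂ P) , areaPath m n (proj₁ P)))

parkingTerms : ℕ → ℕ → List Bool → List ℤ → List Term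
parkingTerms m n π R = map (hikitaTerm m n) (map (π ,_) (filterB (admissible m) (perms R)))

hikita-byPath : (m n : ℕ) →
  hikita m n ≡ concatMap (λ π → parkingTerms m n π (ranksOnPath m n π)) (dyckPaths m n)
hikita-byPath m n = LP.map-concatMap (hikitaTerm m n)
  (λ π → map (π ,_) (filterB (admissible m) (perms (ranksOnPath m n π)))) (dyckPaths m n)

-- For ranks x < y the word x y is always admissible, with no descent and no
-- inversion; the word y x has a descent, and is admissible with one
-- inversion if y < x + m, but is forbidden if y = x + m.
module TwoCells (m n : ℕ) (π : List Bool) {x y : ℤ} (x<y : x ℤ.< y) where

  private
    D A : ℕ
    D = dinvPath m n π
    A = areaPath m n π

    term : (W : List ℤ) {S : List Bool} {k : ℕ} → desW W ≡ S → invW m W ≡ k →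
           hikitaTerm m n (π , W) ≡ (S , (+ D ℤ.- + k , A))
    term W desW≡S invW≡k = cong₂ (λ S k → (S , (+ D ℤ.- + k , A))) desW≡S invW≡k

    admissible-up : admissible m (x ∷ y ∷ []) ≡ true
    admissible-up = cong (λ b → not b ∧ true)
      (⌊⌋-no (ℤP.<⇒≢ (ℤP.<-≤-trans x<y (ℤP.i≤i+j y (+ m)))))

    term-up : hikitaTerm m n (π , x ∷ y ∷ []) ≡ (F∅ , (+ D ℤ.- + 0 , A))
    term-up = term (x ∷ y ∷ []) (cong (_∷ []) noDescent)
                   (cong length (filterB-reject (isInversion m) (x , y) []
                                  (cong (_∧ ⌊ x ℤ.<? y ℤ.+ + m ⌋) noDescent)))
      where
      noDescent : ⌊ y ℤ.<? x ⌋ ≡ false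
      noDescent = ⌊⌋-no (ℤP.<-asym x<y)

  parkingTerms-inside : y ℤ.< x ℤ.+ + m →
    parkingTerms m n π (x ∷ y ∷ []) ≡ (F∅ , (+ D ℤ.- + 0 , A)) ∷ (F₁ , (+ D ℤ.- + 1 , A)) ∷ []
  parkingTerms-inside y<x+m = begin
    map (hikitaTerm m n) (map (π ,_) (filterB (admissible m) ((x ∷ y ∷ []) ∷ (y ∷ x ∷ []) ∷ [])))
      ≡⟨ cong (map (hikitaTerm m n) ∘ map (π ,_))
              (≡-trans (filterB-accept (admissible m) (x ∷ y ∷ []) ((y ∷ x ∷ []) ∷ []) admissible-up)
                       (cong ((x ∷ y ∷ []) ∷_)
                             (filterB-accept (admissible m) (y ∷ x ∷ []) [] admissible-down))) ⟩
    hikitaTerm m n (π , x ∷ y ∷ []) ∷ hikitaTerm m n (π , y ∷ x ∷ []) ∷ []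
      ≡⟨ cong₂ (λ s t → s ∷ t ∷ []) term-up
               (term (y ∷ x ∷ []) (cong (_∷ []) (⌊⌋-yes x<y))
                     (cong length (filterB-accept (isInversion m) (y , x) [] oneInversion))) ⟩
    (F∅ , (+ D ℤ.- + 0 , A)) ∷ (F₁ , (+ D ℤ.- + 1 , A)) ∷ [] ∎
    where
    admissible-down : admissible m (y ∷ x ∷ []) ≡ true
    admissible-down = cong (λ b → not b ∧ true) (⌊⌋-no (ℤP.<⇒≢ y<x+m))
    oneInversion : isInversion m (y , x) ≡ true
    oneInversion = cong₂ _∧_ (⌊⌋-yes {d = x ℤ.<? y} x<y) (⌊⌋-yes {d = y ℤ.<? x ℤ.+ + m} y<x+m)

  parkingTerms-boundary : y ≡ x ℤ.+ + m →
    parkingTerms m n π (x ∷ y ∷ []) ≡ (F∅ , (+ D ℤ.- + 0 , A)) ∷ []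
  parkingTerms-boundary y≡x+m = begin
    map (hikitaTerm m n) (map (π ,_) (filterB (admissible m) ((x ∷ y ∷ []) ∷ (y ∷ x ∷ []) ∷ [])))
      ≡⟨ cong (map (hikitaTerm m n) ∘ map (π ,_))
              (≡-trans (filterB-accept (admissible m) (x ∷ y ∷ []) ((y ∷ x ∷ []) ∷ []) admissible-up)
                       (cong ((x ∷ y ∷ []) ∷_)
                             (filterB-reject (admissible m) (y ∷ x ∷ []) [] forbidden))) ⟩
    hikitaTerm m n (π , x ∷ y ∷ []) ∷ []
      ≡⟨ cong (_∷ []) term-up ⟩
    (F∅ , (+ D ℤ.- + 0 , A)) ∷ [] ∎
    where
    forbidden : admissible m (y ∷ x ∷ []) ≡ false
    forbidden = cong (λ b → not b ∧ true) (⌊⌋-yes y≡x+m)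

module OddWidthAtLeast3 (p' : ℕ) where

  p : ℕ
  p = suc p'

  open OddWidth p

  -- The terms contributed by the parking functions on N E^j N E^(2p+1-j):
  -- q^j t^(p-j) F_∅, and for j = k+1 also q^k t^(p-1-k) F_{1}.
  headTerm tailTerm : ℕ → Term
  headTerm j = (F∅ , (+ j , p ∸ j))
  tailTerm k = (F₁ , (+ k , p' ∸ k))

  termsAt : ℕ → List Term
  termsAt j = headTerm j ∷ atPred tailTerm j

  -- The ranks -2 < 2d-1 of the two cells; 2d-1 < -2 + M iff d < p, while for
  -- d = p (that is, j = 0) the two sides agree by computation.
  rank-order : (d : ℕ) → -[1+ 1 ] ℤ.< twiceMinus1 d
  rank-order zero    = -<- (s≤s z≤n)
  rank-order (suc d) = -<+

  rank-inside : (d : ℕ) → d < p → twiceMinus1 d ℤ.< -[1+ 1 ] ℤ.+ + M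
  rank-inside zero    _       = -<+
  rank-inside (suc d) (s≤s d<p') = +<+ (s≤s (ℕP.*-monoˡ-< 2 d<p'))

  parkingTerms-odd : (j : ℕ) → j ≤ p →
    parkingTerms M 2 (twoRowPath M j) (ranksOnPath M 2 (twoRowPath M j)) ≡ termsAt j
  parkingTerms-odd zero _ = begin
    parkingTerms M 2 π (ranksOnPath M 2 π)
      ≡⟨ cong (parkingTerms M 2 π) (ranks-odd 0 z≤n) ⟩
    parkingTerms M 2 π (-[1+ 1 ] ∷ twiceMinus1 p ∷ [])
      ≡⟨ TwoCells.parkingTerms-boundary M 2 π (rank-order p) ≡-refl ⟩
    (F∅ , (+ dinvPath M 2 π ℤ.- + 0 , areaPath M 2 π)) ∷ []
      ≡⟨ cong₂ (λ d ar → (F∅ , (+ d ℤ.- + 0 , ar)) ∷ []) (dinv-odd 0 z≤n) (area-odd 0) ⟩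
    termsAt 0 ∎
    where
    π : List Bool
    π = twoRowPath M 0
  parkingTerms-odd (suc k) k<p = begin
    parkingTerms M 2 π (ranksOnPath M 2 π)
      ≡⟨ cong (parkingTerms M 2 π) (ranks-odd (suc k) k<p) ⟩
    parkingTerms M 2 π (-[1+ 1 ] ∷ twiceMinus1 (p' ∸ k) ∷ [])
      ≡⟨ TwoCells.parkingTerms-inside M 2 π (rank-order (p' ∸ k))
           (rank-inside (p' ∸ k) (s≤s (ℕP.m∸n≤m p' k))) ⟩
    (F∅ , (+ dinvPath M 2 π ℤ.- + 0 , areaPath M 2 π)) ∷
    (F₁ , (+ dinvPath M 2 π ℤ.- + 1 , areaPath M 2 π)) ∷ []
      ≡⟨ cong₂ (λ d ar → (F∅ , (+ d ℤ.- + 0 , ar)) ∷ (F₁ , (+ d ℤ.- + 1 , ar)) ∷ [])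
               (dinv-odd (suc k) k<p) (area-odd (suc k)) ⟩
    (F∅ , (+ suc k ℤ.- + 0 , p' ∸ k)) ∷ (F₁ , (+ k , p' ∸ k)) ∷ []
      ≡⟨ cong (λ z → (F∅ , (z , p' ∸ k)) ∷ tailTerm k ∷ []) (ℤP.+-identityʳ (+ suc k)) ⟩
    termsAt (suc k) ∎
    where
    π : List Bool
    π = twoRowPath M (suc k)

  hikita-odd : hikita M 2 ≡ concatMap termsAt (downFrom (suc p))
  hikita-odd = begin
    hikita M 2
      ≡⟨ hikita-byPath M 2 ⟩
    concatMap pathTerms (dyckPaths M 2)
      ≡⟨ cong (concatMap pathTerms) dyckPaths-odd ⟩
    concatMap pathTerms (map (twoRowPath M) (downFrom (suc p)))
      ≡⟨ LP.concatMap-map pathTerms (twoRowPath M) (downFrom (suc p)) ⟩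
    concatMap (pathTerms ∘ twoRowPath M) (downFrom (suc p))
      ≡⟨ cong concat (map-downFrom-cong (suc p) (λ j j<1+p → parkingTerms-odd j (ℕP.≤-pred j<1+p))) ⟩
    concatMap termsAt (downFrom (suc p)) ∎
    where
    pathTerms : List Bool → List Term
    pathTerms π = parkingTerms M 2 π (ranksOnPath M 2 π)

  separated : map headTerm (downFrom (suc p)) ++ concatMap (atPred tailTerm) (downFrom (suc p))
              ≡ (C M 2 ·s₁₁) ++ (C (M ∸ 2) 2 ·s₂)
  separated = sym (cong₂ _++_
    (≡-trans (cong (map (F∅ ,_)) C-odd) (sym (LP.map-∘ (downFrom (suc p)))))
    (≡-trans (cong (map (F₁ ,_)) (OddWidth.C-odd p'))
             (≡-trans (sym (LP.map-∘ (downFrom p))) (sym (concatMap-atPred tailTerm p)))))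

  theorem : hikita M 2 ≋ ((C M 2 ·s₁₁) ++ (C (M ∸ 2) 2 ·s₂))
  theorem = ↭⇒≋ (subst₂ _↭_ (sym hikita-odd) separated
                  (concatMap-∷-↭ headTerm (atPred tailTerm) (downFrom (suc p))))

odd-form : (m : ℕ) → 3 ≤ m → m % 2 ≡ 1 → ∃[ p' ] m ≡ suc (suc p' * 2)
odd-form m 3≤m m%2≡1 with m / 2 | ≡-trans (m≡m%n+[m/n]*n m 2) (cong (_+ (m / 2) * 2) m%2≡1)
... | suc p' | m≡2p+1 = p' , m≡2p+1
... | zero   | m≡1    = ⊥-elim (3≰1 (subst (3 ≤_) m≡1 3≤m))
  where
  3≰1 : ¬ 3 ≤ 1
  3≰1 (s≤s ())

mainTheorem3 : (m : ℕ) → 3 ≤ m → m % 2 ≡ 1 →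
    hikita m 2 ≋ ((C m 2 ·s₁₁) ++ (C (m ∸ 2) 2 ·s₂))
mainTheorem3 m 3≤m m%2≡1 with odd-form m 3≤m m%2≡1
... | p' , ≡-refl = OddWidthAtLeast3.theorem p'
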